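{- Let $n\ge 2$ be an integer and let $D_{2n}=\langle x,y : x^n=e,\ y^2=e,\ yxy^{ -1}=x^{ -1}\rangle$ be the dihedral group of order $2n$. Then the order supergraph $\mathcal{S}(D_{2n})$ is the line graph of some graph if and only if $n=p^{\alpha}$ for some prime $p$ and some integer $\alpha\ge 1$.
   Context: For a finite group $G$, the order supergraph $\mathcal{S}(G)$ is the simple undirected graph with vertex set $G$ in which distinct $x,y$ are adjacent if and only if $o(x)\mid o(y)$ or $o(y)\mid o(x)$, where $o(x)$ is the order of $x$. A graph is a line graph if it is isomorphic to the line graph $L(\Gamma)$ of some simple graph $\Gamma$ (vertices of $L(\Gamma)$ are the edges of $\Gamma$, adjacent when they share an endpoint). -}

module Defs where

open import Data.Nat using (ℕ; zero; suc; _+_; _∸_; _^_; _≤_; _<_; NonZero)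
open import Data.Nat.DivMod using (_mod_)
open import Data.Nat.Divisibility using (_∣_)
open import Data.Nat.Primality using (Prime)
open import Data.Fin using (Fin; toℕ)
open import Data.Bool using (Bool; true; false; _xor_)
open import Data.Product using (Σ; _×_; _,_; proj₁; proj₂; ∃)
open import Data.Sum using (_⊎_)
open import Relation.Nullary using (¬_)
open import Relation.Binary.PropositionalEquality using (_≡_; _≢_)
open import Function.Bundles using (_⇔_)

-- The dihedral group D_{2n} of order 2n, concretely:
-- (i , false) stands for x^i  and  (i , true) stands for x^i y,
-- with i ∈ ℤ/nℤ.  Multiplication:
--   (x^i y^s)(x^j y^t) = x^(i + (-1)^s j) y^(s xor t),
-- which realises the presentation ⟨x,y | x^n = y^2 = e, y x y⁻¹ = x⁻¹⟩.

module Dihedral (n : ℕ) .{{_ : NonZero n}} where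

  D : Set
  D = Fin n × Bool

  e : D
  e = (0 mod n , false)

  signed : Bool → Fin n → ℕ
  signed false j = toℕ j
  signed true  j = n ∸ toℕ j

  _·_ : D → D → D
  (i , s) · (j , t) = ((toℕ i + signed s j) mod n , s xor t)

  pow : D → ℕ → D
  pow g zero    = e
  pow g (suc k) = g · pow g k

  IsOrder : D → ℕ → Set
  IsOrder g k = (0 < k) × (pow g k ≡ e) × (∀ j → 0 < j → j < k → pow g j ≢ e)

  SAdj : D → D → Set
  SAdj g h = (g ≢ h) × ∃ λ a → ∃ λ b → IsOrder g a × IsOrder h b × ((a ∣ b) ⊎ (b ∣ a))

-- A graph on vertex type A with adjacency Adj is a line graph iff it is
-- isomorphic to L(Γ) for some (finite) simple graph Γ.  We take Γ with
-- vertex set Fin m; an edge {u,v} of Γ is encoded as a pair (u , v) with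
-- toℕ u < toℕ v.  An isomorphism A ≅ L(Γ) is then an injective map f
-- from A to such pairs (Γ's edge set being exactly the image of f),
-- such that distinct a, b are adjacent iff f a and f b share an endpoint.

Edge : ℕ → Set
Edge m = Σ (Fin m × Fin m) λ uv → toℕ (proj₁ uv) < toℕ (proj₂ uv)

ShareEndpoint : ∀ {m} → Edge m → Edge m → Set
ShareEndpoint ((u , v) , _) ((u' , v') , _) =
  (u ≡ u') ⊎ (u ≡ v') ⊎ (v ≡ u') ⊎ (v ≡ v')

IsLineGraph : (A : Set) → (A → A → Set) → Set
IsLineGraph A Adj =
  ∃ λ (m : ℕ) → ∃ λ (f : A → Edge m) →
    (∀ a b → f a ≡ f b → a ≡ b) ×
    (∀ a b → a ≢ b → (Adj a b ⇔ ShareEndpoint (f a) (f b)))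

IsPrimePower : ℕ → Set
IsPrimePower n = ∃ λ p → ∃ λ α → Prime p × 1 ≤ α × n ≡ p ^ α

-- The order of a rotation x^i is the least k > 0 with n ∣ k·i, the order of a reflection is 2.
--
-- If n has distinct prime divisors p and q, then e, x and x⁻¹ (orders 1, n, n) are pairwise
-- adjacent and adjacent to rotations u, v of orders p and q, while u and v are not adjacent:
-- an induced K₅ − e.  No line graph contains one: the edges c₁, c₂, c₃ each meet both of the
-- disjoint edges u and v, so each joins an end a of u to an end b of v; two distinct meeting
-- ones share exactly one end, so the parities a xor b of the three are pairwise distinct.
--
-- If n = 2^α every order is a power of 2, so S(D_{2n}) is complete: the line graph of a star.
-- If n = p^α with p odd, the rotations form a clique, the reflections form a clique, and the
-- only other edges join e to the reflections: the line graph of two stars whose centres are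
-- joined by the edge representing e.

module Submission where

open import Defs
open import Data.Bool using (Bool; true; false; not; _xor_)
open import Data.Bool.Properties using (not-involutive)
open import Data.Empty using (⊥; ⊥-elim)
open import Data.Fin using (Fin; zero; suc; toℕ; fromℕ<; join; splitAt)
import Data.Fin.Properties as Fin
open import Data.Fin.Properties using (toℕ-injective; toℕ-fromℕ<; toℕ<n; toℕ-↑ˡ; toℕ-↑ʳ; splitAt-join)
open import Data.List using (List; []; _∷_)
open import Data.List.Relation.Unary.All using (All; []; _∷_)
open import Data.Nat
open import Data.Nat.DivMod
  using (_mod_; m≡m%n+[m/n]*n; m%n<n; m<n⇒m%n≡m; n%n≡0; [m+n]%n≡m%n; %-distribˡ-+; m%n%n≡m%n)
open import Data.Nat.Divisibility
open import Data.Nat.Coprimality using (Coprime; coprime-divisor)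
open import Data.Nat.ListAction using (product)
open import Data.Nat.Primality using (Prime; prime[2]; prime⇒irreducible; prime⇒nonZero; prime⇒nonTrivial)
open import Data.Nat.Primality.Factorisation using (factorise)
open import Data.Nat.Properties
open import Data.Nat.Tactic.RingSolver using (solve-∀)
open import Data.Product using (_×_; _,_; proj₁; ∃; ∃₂)
open import Data.Sum using (_⊎_; inj₁; inj₂; [_,_]′; swap)
open import Function using (_∘′_)
open import Function.Bundles using (_⇔_; mk⇔; Equivalence)
open import Function.Properties.Equivalence using () renaming (sym to ⇔-sym; trans to ⇔-trans)
open import Relation.Binary.Definitions using (tri<; tri≈; tri>)
open import Relation.Binary.PropositionalEquality
open import Relation.Nullary using (¬_; yes; no)
open import Relation.Unary using (Decidable)

xor-≡⇒≡⊎≡not : ∀ a b c d → a xor b ≡ c xor d → (c , d) ≡ (a , b) ⊎ (c , d) ≡ (not a , not b)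
xor-≡⇒≡⊎≡not false b false d refl = inj₁ refl
xor-≡⇒≡⊎≡not false _ true  d refl = inj₂ (cong (true ,_) (sym (not-involutive d)))
xor-≡⇒≡⊎≡not true  b false _ refl = inj₂ refl
xor-≡⇒≡⊎≡not true  b true  d eq   =
  inj₁ (cong (true ,_) (trans (sym (not-involutive d)) (trans (cong not (sym eq)) (not-involutive b))))

pigeonhole-Bool : ∀ (x y z : Bool) → x ≡ y ⊎ x ≡ z ⊎ y ≡ z
pigeonhole-Bool false false _     = inj₁ refl
pigeonhole-Bool true  true  _     = inj₁ refl
pigeonhole-Bool false true  false = inj₂ (inj₁ refl)
pigeonhole-Bool false true  true  = inj₂ (inj₂ refl)
pigeonhole-Bool true  false false = inj₂ (inj₂ refl)
pigeonhole-Bool true  false true  = inj₂ (inj₁ refl)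

-- Edges of a simple graph

module _ {m : ℕ} where

  endpoint : Edge m → Bool → Fin m
  endpoint ((u , _) , _) false = u
  endpoint ((_ , v) , _) true  = v

  endpoint-< : ∀ E → toℕ (endpoint E false) < toℕ (endpoint E true)
  endpoint-< (_ , u<v) = u<v

  endpoint-distinct : ∀ E i → endpoint E i ≢ endpoint E (not i)
  endpoint-distinct E false eq = <-irrefl (cong toℕ eq) (endpoint-< E)
  endpoint-distinct E true  eq = <-irrefl (cong toℕ (sym eq)) (endpoint-< E)

  edge-≡ : ∀ {E F} → endpoint E false ≡ endpoint F false → endpoint E true ≡ endpoint F true → E ≡ F
  edge-≡ {(u , v) , u<v} {(.u , .v) , u<v′} refl refl = cong ((u , v) ,_) (<-irrelevant u<v u<v′)

  Meet : Edge m → Edge m → Set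
  Meet E F = ∃₂ λ i j → endpoint E i ≡ endpoint F j

  share⇒meet : ∀ E F → ShareEndpoint E F → Meet E F
  share⇒meet E F (inj₁ eq)                = false , false , eq
  share⇒meet E F (inj₂ (inj₁ eq))         = false , true  , eq
  share⇒meet E F (inj₂ (inj₂ (inj₁ eq)))  = true  , false , eq
  share⇒meet E F (inj₂ (inj₂ (inj₂ eq)))  = true  , true  , eq

  meet⇒share : ∀ E F → Meet E F → ShareEndpoint E F
  meet⇒share E F (false , false , eq) = inj₁ eq
  meet⇒share E F (false , true  , eq) = inj₂ (inj₁ eq)
  meet⇒share E F (true  , false , eq) = inj₂ (inj₂ (inj₁ eq))
  meet⇒share E F (true  , true  , eq) = inj₂ (inj₂ (inj₂ eq))

  shareEndpoint-sym : ∀ E F → ShareEndpoint E F → ShareEndpoint F E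
  shareEndpoint-sym E F share with share⇒meet E F share
  ... | i , j , eq = meet⇒share F E (j , i , sym eq)

  Joins : Edge m → Fin m → Fin m → Set
  Joins E x y = ∃ λ i → endpoint E i ≡ x × endpoint E (not i) ≡ y

  joins-endpoint : ∀ {E x y} → Joins E x y → ∀ k → endpoint E k ≡ x ⊎ endpoint E k ≡ y
  joins-endpoint (false , ex , ey) false = inj₁ ex
  joins-endpoint (false , ex , ey) true  = inj₂ ey
  joins-endpoint (true  , ex , ey) false = inj₂ ey
  joins-endpoint (true  , ex , ey) true  = inj₁ ex

  joins-unique : ∀ E F {x y} → Joins E x y → Joins F x y → E ≡ F
  joins-unique E F (false , ex , ey) (false , fx , fy) = edge-≡ (trans ex (sym fx)) (trans ey (sym fy))
  joins-unique E F (true  , ex , ey) (true  , fx , fy) = edge-≡ (trans ey (sym fy)) (trans ex (sym fx))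
  joins-unique E F (false , ex , ey) (true  , fx , fy) = ⊥-elim (reversed E F (trans ex (sym fx)) (trans ey (sym fy)))
    where
    reversed : ∀ E F → endpoint E false ≡ endpoint F true → endpoint E true ≡ endpoint F false → ⊥
    reversed E F p q = <-asym (endpoint-< E) (subst₂ (λ a b → toℕ a < toℕ b) (sym q) (sym p) (endpoint-< F))
  joins-unique E F jE@(true , _) jF@(false , _) = sym (joins-unique F E jF jE)

  module _ {A B : Edge m} (A∦B : ¬ Meet A B) where

    meetsBoth⇒joins : ∀ {E} → Meet E A → Meet E B → ∃₂ λ a b → Joins E (endpoint A a) (endpoint B b)
    meetsBoth⇒joins (false , a , ea) (false , b , eb) = ⊥-elim (A∦B (a , b , trans (sym ea) eb))
    meetsBoth⇒joins (true  , a , ea) (true  , b , eb) = ⊥-elim (A∦B (a , b , trans (sym ea) eb))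
    meetsBoth⇒joins (false , a , ea) (true  , b , eb) = a , b , false , ea , eb
    meetsBoth⇒joins (true  , a , ea) (false , b , eb) = a , b , true , ea , eb

    joins-opposite⇒¬meet : ∀ {E F} a b → Joins E (endpoint A a) (endpoint B b) →
      Joins F (endpoint A (not a)) (endpoint B (not b)) → ¬ Meet E F
    joins-opposite⇒¬meet a b jE jF (k , l , eq) with joins-endpoint jE k | joins-endpoint jF l
    ... | inj₁ p | inj₁ q = endpoint-distinct A a (trans (sym p) (trans eq q))
    ... | inj₁ p | inj₂ q = A∦B (a , not b , trans (sym p) (trans eq q))
    ... | inj₂ p | inj₁ q = A∦B (not a , b , trans (sym q) (trans (sym eq) p))
    ... | inj₂ p | inj₂ q = endpoint-distinct B b (trans (sym p) (trans eq q))

    -- Distinct meeting edges joining A to B share exactly one end, so their codes (a , b)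
    -- differ in exactly one coordinate.
    meeting-joins-parity : ∀ {E F} a b c d → Joins E (endpoint A a) (endpoint B b) →
      Joins F (endpoint A c) (endpoint B d) → E ≢ F → Meet E F → a xor b ≢ c xor d
    meeting-joins-parity {E} {F} a b c d jE jF E≢F EF eq with xor-≡⇒≡⊎≡not a b c d eq
    ... | inj₁ refl = E≢F (joins-unique E F jE jF)
    ... | inj₂ refl = joins-opposite⇒¬meet a b jE jF EF

  triangle-over-disjoint-pair : ∀ {A B E₁ E₂ E₃} → ¬ Meet A B →
    E₁ ≢ E₂ → E₁ ≢ E₃ → E₂ ≢ E₃ → Meet E₁ E₂ → Meet E₁ E₃ → Meet E₂ E₃ →
    Meet E₁ A → Meet E₂ A → Meet E₃ A → Meet E₁ B → Meet E₂ B → Meet E₃ B → ⊥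
  triangle-over-disjoint-pair A∦B E₁≢E₂ E₁≢E₃ E₂≢E₃ E₁E₂ E₁E₃ E₂E₃ E₁A E₂A E₃A E₁B E₂B E₃B
    with meetsBoth⇒joins A∦B E₁A E₁B | meetsBoth⇒joins A∦B E₂A E₂B | meetsBoth⇒joins A∦B E₃A E₃B
  ... | a₁ , b₁ , j₁ | a₂ , b₂ , j₂ | a₃ , b₃ , j₃
    with pigeonhole-Bool (a₁ xor b₁) (a₂ xor b₂) (a₃ xor b₃)
  ... | inj₁ eq        = meeting-joins-parity A∦B a₁ b₁ a₂ b₂ j₁ j₂ E₁≢E₂ E₁E₂ eq
  ... | inj₂ (inj₁ eq) = meeting-joins-parity A∦B a₁ b₁ a₃ b₃ j₁ j₃ E₁≢E₃ E₁E₃ eq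
  ... | inj₂ (inj₂ eq) = meeting-joins-parity A∦B a₂ b₂ a₃ b₃ j₂ j₃ E₂≢E₃ E₂E₃ eq

-- Line graphs

record InducedK₅-e {A : Set} (Adj : A → A → Set) : Set where
  field
    c₁ c₂ c₃ u v : A
    c₁~c₂ : Adj c₁ c₂
    c₁~c₃ : Adj c₁ c₃
    c₂~c₃ : Adj c₂ c₃
    c₁~u : Adj c₁ u
    c₂~u : Adj c₂ u
    c₃~u : Adj c₃ u
    c₁~v : Adj c₁ v
    c₂~v : Adj c₂ v
    c₃~v : Adj c₃ v
    u≢v : u ≢ v
    u≁v : ¬ Adj u v

lineGraph⇒¬inducedK₅-e : ∀ {A Adj} → (∀ {x y} → Adj x y → x ≢ y) →
  IsLineGraph A Adj → ¬ InducedK₅-e Adj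
lineGraph⇒¬inducedK₅-e {Adj = Adj} irrefl (m , f , f-injective , adj⇔share) K =
  triangle-over-disjoint-pair u∦v
    (distinct c₁~c₂) (distinct c₁~c₃) (distinct c₂~c₃) (meet c₁~c₂) (meet c₁~c₃) (meet c₂~c₃)
    (meet c₁~u) (meet c₂~u) (meet c₃~u) (meet c₁~v) (meet c₂~v) (meet c₃~v)
  where
  open InducedK₅-e K
  meet : ∀ {x y} → Adj x y → Meet (f x) (f y)
  meet {x} {y} x~y = share⇒meet (f x) (f y) (Equivalence.to (adj⇔share x y (irrefl x~y)) x~y)
  distinct : ∀ {x y} → Adj x y → f x ≢ f y
  distinct {x} {y} x~y = irrefl x~y ∘′ f-injective x y
  u∦v : ¬ Meet (f u) (f v)
  u∦v uv = u≁v (Equivalence.from (adj⇔share u v u≢v) (meet⇒share (f u) (f v) uv))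

complete⇒lineGraph : ∀ {A Adj m} (ι : A → Fin m) → (∀ a b → ι a ≡ ι b → a ≡ b) →
  (∀ a b → a ≢ b → Adj a b) → IsLineGraph A Adj
complete⇒lineGraph {A} {m = m} ι ι-injective complete = suc m , spoke , spoke-injective ,
  λ a b a≢b → mk⇔ (λ _ → inj₁ refl) (λ _ → complete a b a≢b)
  where
  spoke : A → Edge (suc m)
  spoke a = (zero , suc (ι a)) , z<s
  spoke-injective : ∀ a b → spoke a ≡ spoke b → a ≡ b
  spoke-injective a b eq = ι-injective a b (Fin.suc-injective (cong (λ E → endpoint E true) eq))

-- Least positive witnesses

-- IsOrder g is definitionally IsLeastPositive (λ j → pow g j ≡ e).
IsLeastPositive : (ℕ → Set) → ℕ → Set
IsLeastPositive P k = 0 < k × P k × (∀ j → 0 < j → j < k → ¬ P j)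

module _ {P : ℕ → Set} where

  leastPositive-unique : ∀ {k l} → IsLeastPositive P k → IsLeastPositive P l → k ≡ l
  leastPositive-unique {k} {l} (0<k , Pk , k-least) (0<l , Pl , l-least) with <-cmp k l
  ... | tri< k<l _ _ = ⊥-elim (l-least k 0<k k<l Pk)
  ... | tri≈ _ k≡l _ = k≡l
  ... | tri> _ _ l<k = ⊥-elim (k-least l 0<l l<k Pl)

  leastPositive-cong : ∀ {Q k} → (∀ j → P j ⇔ Q j) → IsLeastPositive P k ⇔ IsLeastPositive Q k
  leastPositive-cong P⇔Q = mk⇔
    (λ (0<k , Pk , k-least) → 0<k , Equivalence.to (P⇔Q _) Pk ,
                                λ j 0<j j<k Qj → k-least j 0<j j<k (Equivalence.from (P⇔Q j) Qj))
    (λ (0<k , Qk , k-least) → 0<k , Equivalence.from (P⇔Q _) Qk ,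
                                λ j 0<j j<k Pj → k-least j 0<j j<k (Equivalence.to (P⇔Q j) Pj))

  module _ (P? : Decidable P) where

    noneUpTo⊎leastPositive : ∀ b → (∀ j → 0 < j → j ≤ b → ¬ P j) ⊎ ∃ (IsLeastPositive P)
    noneUpTo⊎leastPositive zero = inj₁ λ j 0<j j≤0 _ → <⇒≱ 0<j j≤0
    noneUpTo⊎leastPositive (suc b) with noneUpTo⊎leastPositive b
    ... | inj₂ least = inj₂ least
    ... | inj₁ none with P? (suc b)
    ...   | yes Psb = inj₂ (suc b , z<s , Psb , λ j 0<j j<sb → none j 0<j (s≤s⁻¹ j<sb))
    ...   | no ¬Psb = inj₁ λ j 0<j j≤sb →
      [ (λ j<sb → none j 0<j (s≤s⁻¹ j<sb)) , (λ j≡sb → ¬Psb ∘′ subst P j≡sb) ]′ (m≤n⇒m<n∨m≡n j≤sb)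

    leastPositive-exists : ∀ {m} → 0 < m → P m → ∃ (IsLeastPositive P)
    leastPositive-exists {m} 0<m Pm with noneUpTo⊎leastPositive m
    ... | inj₁ none  = ⊥-elim (none m 0<m ≤-refl Pm)
    ... | inj₂ least = least

-- The order of a residue modulo n

IsAdditiveOrder : ℕ → ℕ → ℕ → Set
IsAdditiveOrder n i = IsLeastPositive (λ j → n ∣ j * i)

additiveOrder-∣ : ∀ {n i k j} → IsAdditiveOrder n i k → n ∣ j * i → k ∣ j
additiveOrder-∣ {n} {i} {k@(suc _)} {j} (_ , n∣ki , k-least) n∣ji with j % k ≟ 0
... | yes j%k≡0 = m%n≡0⇒n∣m j k j%k≡0
... | no  j%k≢0 = ⊥-elim (k-least (j % k) (n≢0⇒n>0 j%k≢0) (m%n<n j k) n∣ri)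
  where
  ji≡ : j * i ≡ (j / k) * (k * i) + (j % k) * i
  ji≡ = begin
    j * i                         ≡⟨ cong (_* i) (m≡m%n+[m/n]*n j k) ⟩
    (j % k + (j / k) * k) * i     ≡⟨ rearrange (j % k) (j / k) k i ⟩
    (j / k) * (k * i) + (j % k) * i ∎
    where
    open ≡-Reasoning
    rearrange : ∀ r q k i → (r + q * k) * i ≡ q * (k * i) + r * i
    rearrange = solve-∀
  n∣ri : n ∣ (j % k) * i
  n∣ri = ∣m+n∣m⇒∣n (subst (n ∣_) ji≡ n∣ji) (∣n⇒∣m*n (j / k) n∣ki)

additiveOrder-exists : ∀ n .{{_ : NonZero n}} i → ∃ (IsAdditiveOrder n i)
additiveOrder-exists n i = leastPositive-exists (λ j → n ∣? j * i) (>-nonZero⁻¹ n) (m∣m*n i)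

additiveOrder-quotient : ∀ {n k} .{{_ : NonZero n}} (k∣n : k ∣ n) → IsAdditiveOrder n (quotient k∣n) k
additiveOrder-quotient {n} {zero} k∣n = ⊥-elim (≢-nonZero⁻¹ n (m∣n⇒n≡m*quotient k∣n))
additiveOrder-quotient {n} {k@(suc _)} k∣n = z<s , ∣-reflexive n≡kq , k-least
  where
  instance _ = quotient≢0 k∣n
  n≡kq : n ≡ k * quotient k∣n
  n≡kq = m∣n⇒n≡m*quotient k∣n
  k-least : ∀ j → 0 < j → j < k → ¬ n ∣ j * quotient k∣n
  k-least j 0<j j<k n∣jq =
    >⇒∤ {{>-nonZero 0<j}} j<k (*-cancelʳ-∣ (quotient k∣n) (subst (_∣ j * quotient k∣n) n≡kq n∣jq))

additiveOrder-pred : ∀ n .{{_ : NonZero n}} → IsAdditiveOrder n (pred n) n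
additiveOrder-pred n@(suc n-1) = z<s , m∣m*n n-1 , n-least
  where
  -- j·(n-1) + j = j·n, so n ∣ j·(n-1) forces n ∣ j.
  n-least : ∀ j → 0 < j → j < n → ¬ n ∣ j * n-1
  n-least j 0<j j<n n∣j[n-1] = >⇒∤ {{>-nonZero 0<j}} j<n
    (∣m+n∣m⇒∣n (subst (n ∣_) (trans (*-suc j n-1) (+-comm j (j * n-1))) (n∣m*n j)) n∣j[n-1])

-- Prime powers

infix 4 _∣⊎∣_

_∣⊎∣_ : ℕ → ℕ → Set
a ∣⊎∣ b = a ∣ b ⊎ b ∣ a

1<p : ∀ {p} → Prime p → 1 < p
1<p {p} p-prime = nonTrivial⇒n>1 p {{prime⇒nonTrivial p-prime}}

prime∣prime⇒≡ : ∀ {p q} → Prime p → Prime q → p ∣ q → p ≡ q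
prime∣prime⇒≡ p-prime q-prime p∣q with prime⇒irreducible q-prime p∣q
... | inj₁ p≡1 = ⊥-elim (<-irrefl (sym p≡1) (1<p p-prime))
... | inj₂ p≡q = p≡q

distinctPrimes-∤ : ∀ {p q} → Prime p → Prime q → p ≢ q → ¬ (p ∣⊎∣ q)
distinctPrimes-∤ p-prime q-prime p≢q (inj₁ p∣q) = p≢q (prime∣prime⇒≡ p-prime q-prime p∣q)
distinctPrimes-∤ p-prime q-prime p≢q (inj₂ q∣p) = p≢q (sym (prime∣prime⇒≡ q-prime p-prime q∣p))

∣p^α⇒≡p^β : ∀ {p} → Prime p → ∀ α {d} → d ∣ p ^ α → ∃ λ β → d ≡ p ^ β
∣p^α⇒≡p^β p-prime zero d∣1 = 0 , ∣1⇒≡1 d∣1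
∣p^α⇒≡p^β {p} p-prime (suc α) {d} d∣p^[1+α] with p ∣? d
... | yes (divides c d≡c*p) with ∣p^α⇒≡p^β p-prime α c∣p^α
  where
  c∣p^α : c ∣ p ^ α
  c∣p^α = *-cancelˡ-∣ p {{prime⇒nonZero p-prime}}
    (subst (_∣ p * p ^ α) (trans d≡c*p (*-comm c p)) d∣p^[1+α])
...   | β , c≡p^β = suc β , trans d≡c*p (trans (cong (_* p) c≡p^β) (*-comm (p ^ β) p))
∣p^α⇒≡p^β {p} p-prime (suc α) {d} d∣p^[1+α] | no p∤d =
  ∣p^α⇒≡p^β p-prime α (coprime-divisor d⊥p d∣p^[1+α])
  where
  d⊥p : Coprime d p
  d⊥p (x∣d , x∣p) with prime⇒irreducible p-prime x∣p
  ... | inj₁ x≡1 = x≡1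
  ... | inj₂ refl = ⊥-elim (p∤d x∣d)

^-monoʳ-∣ : ∀ p {β γ} → β ≤ γ → p ^ β ∣ p ^ γ
^-monoʳ-∣ p z≤n = 1∣ _
^-monoʳ-∣ p (s≤s β≤γ) = *-monoʳ-∣ p (^-monoʳ-∣ p β≤γ)

^-∣⊎∣ : ∀ p β γ → p ^ β ∣⊎∣ p ^ γ
^-∣⊎∣ p β γ with ≤-total β γ
... | inj₁ β≤γ = inj₁ (^-monoʳ-∣ p β≤γ)
... | inj₂ γ≤β = inj₂ (^-monoʳ-∣ p γ≤β)

oddPrimePower-∣⊎∣2⇒≡1 : ∀ {p} → Prime p → p ≢ 2 → ∀ β → p ^ β ∣⊎∣ 2 → p ^ β ≡ 1
oddPrimePower-∣⊎∣2⇒≡1 p-prime p≢2 zero _ = refl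
oddPrimePower-∣⊎∣2⇒≡1 {p} p-prime p≢2 (suc β) p^[1+β]∣⊎∣2 =
  ⊥-elim (p≢2 (prime∣prime⇒≡ p-prime prime[2] (p∣2 p^[1+β]∣⊎∣2)))
  where
  p∣2 : p ^ suc β ∣⊎∣ 2 → p ∣ 2
  p∣2 (inj₁ p^[1+β]∣2) = ∣-trans (m∣m*n (p ^ β)) p^[1+β]∣2
  p∣2 (inj₂ 2∣p^[1+β]) with ∣p^α⇒≡p^β p-prime (suc β) 2∣p^[1+β]
  ... | suc γ , 2≡p^[1+γ] = subst (p ∣_) (sym 2≡p^[1+γ]) (m∣m*n (p ^ γ))

HasTwoPrimeDivisors : ℕ → Set
HasTwoPrimeDivisors n = ∃₂ λ p q → Prime p × Prime q × p ≢ q × p ∣ n × q ∣ n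

primePower⊎otherPrimeFactor : ∀ p {qs : List ℕ} → All Prime qs →
  (∃ λ k → product qs ≡ p ^ k) ⊎ (∃ λ q → Prime q × q ≢ p × q ∣ product qs)
primePower⊎otherPrimeFactor p [] = inj₁ (0 , refl)
primePower⊎otherPrimeFactor p {q ∷ qs} (q-prime ∷ qs-prime) with q ≟ p
... | no q≢p = inj₂ (q , q-prime , q≢p , m∣m*n (product qs))
... | yes refl with primePower⊎otherPrimeFactor p qs-prime
...   | inj₁ (k , qs≡p^k) = inj₁ (suc k , cong (p *_) qs≡p^k)
...   | inj₂ (r , r-prime , r≢p , r∣qs) = inj₂ (r , r-prime , r≢p , ∣n⇒∣m*n p r∣qs)

primePower⊎twoPrimeDivisors : ∀ n → 2 ≤ n → IsPrimePower n ⊎ HasTwoPrimeDivisors n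
primePower⊎twoPrimeDivisors n@(suc _) 2≤n with factorise n
... | record { factors = [] ; isFactorisation = n≡1 } = ⊥-elim (<-irrefl (sym n≡1) 2≤n)
... | record { factors = p ∷ ps ; isFactorisation = n≡p*ps ; factorsPrime = p-prime ∷ ps-prime }
    with primePower⊎otherPrimeFactor p ps-prime
...   | inj₁ (k , ps≡p^k) = inj₁ (p , suc k , p-prime , s≤s z≤n , trans n≡p*ps (cong (p *_) ps≡p^k))
...   | inj₂ (q , q-prime , q≢p , q∣ps) =
          inj₂ (p , q , p-prime , q-prime , q≢p ∘′ sym ,
                subst (p ∣_) (sym n≡p*ps) (m∣m*n _) , subst (q ∣_) (sym n≡p*ps) (∣n⇒∣m*n p q∣ps))

-- The order supergraph of the dihedral group

module OrderSupergraph (n : ℕ) .{{_ : NonZero n}} where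
  open Dihedral n

  toℕ-mod : ∀ k → toℕ (k mod n) ≡ k % n
  toℕ-mod k = toℕ-fromℕ< (m%n<n k n)

  mod-cong : ∀ {a b} → a % n ≡ b % n → a mod n ≡ b mod n
  mod-cong {a} {b} eq = toℕ-injective (trans (toℕ-mod a) (trans eq (sym (toℕ-mod b))))

  toℕ-mod-toℕ : ∀ (i : Fin n) → toℕ i mod n ≡ i
  toℕ-mod-toℕ i = toℕ-injective (trans (toℕ-mod (toℕ i)) (m<n⇒m%n≡m (toℕ<n i)))

  0%n≡0 : 0 % n ≡ 0
  0%n≡0 = m<n⇒m%n≡m (>-nonZero⁻¹ n)

  toℕ-e : toℕ (proj₁ e) ≡ 0
  toℕ-e = trans (toℕ-mod 0) 0%n≡0

  ·-identityʳ : ∀ g → g · e ≡ g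
  ·-identityʳ (i , false) = cong (_, false) (begin
    (toℕ i + toℕ (0 mod n)) mod n ≡⟨ cong (λ z → (toℕ i + z) mod n) toℕ-e ⟩
    (toℕ i + 0) mod n             ≡⟨ cong (_mod n) (+-identityʳ (toℕ i)) ⟩
    toℕ i mod n                   ≡⟨ toℕ-mod-toℕ i ⟩
    i                             ∎)
    where open ≡-Reasoning
  ·-identityʳ (i , true) = cong (_, true) (begin
    (toℕ i + (n ∸ toℕ (0 mod n))) mod n ≡⟨ cong (λ z → (toℕ i + (n ∸ z)) mod n) toℕ-e ⟩
    (toℕ i + n) mod n                   ≡⟨ mod-cong ([m+n]%n≡m%n (toℕ i) n) ⟩
    toℕ i mod n                         ≡⟨ toℕ-mod-toℕ i ⟩
    i                                   ∎)
    where open ≡-Reasoning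

  reflection²≡e : ∀ i → (i , true) · (i , true) ≡ e
  reflection²≡e i = cong (_, false) (mod-cong (begin
    (toℕ i + (n ∸ toℕ i)) % n ≡⟨ cong (_% n) (m+[n∸m]≡n (<⇒≤ (toℕ<n i))) ⟩
    n % n                     ≡⟨ n%n≡0 n ⟩
    0                         ≡⟨ 0%n≡0 ⟨
    0 % n                     ∎))
    where open ≡-Reasoning

  [m+n%d]%d≡[m+n]%d : ∀ a b → (a + b % n) % n ≡ (a + b) % n
  [m+n%d]%d≡[m+n]%d a b = begin
    (a + b % n) % n             ≡⟨ %-distribˡ-+ a (b % n) n ⟩
    (a % n + b % n % n) % n     ≡⟨ cong (λ z → (a % n + z) % n) (m%n%n≡m%n b n) ⟩
    (a % n + b % n) % n         ≡⟨ %-distribˡ-+ a b n ⟨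
    (a + b) % n                 ∎
    where open ≡-Reasoning

  pow-rotation : ∀ i k → pow (i , false) k ≡ ((k * toℕ i) mod n , false)
  pow-rotation i zero = refl
  pow-rotation i (suc k) = begin
    (i , false) · pow (i , false) k                   ≡⟨ cong ((i , false) ·_) (pow-rotation i k) ⟩
    ((toℕ i + toℕ ((k * toℕ i) mod n)) mod n , false) ≡⟨ cong (_, false) (mod-cong (begin
      (toℕ i + toℕ ((k * toℕ i) mod n)) % n ≡⟨ cong (λ z → (toℕ i + z) % n) (toℕ-mod (k * toℕ i)) ⟩
      (toℕ i + (k * toℕ i) % n) % n         ≡⟨ [m+n%d]%d≡[m+n]%d (toℕ i) (k * toℕ i) ⟩
      (toℕ i + k * toℕ i) % n               ∎)) ⟩
    ((suc k * toℕ i) mod n , false)                   ∎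
    where open ≡-Reasoning

  rotation≡e⇔ : ∀ k → ((k mod n) , false) ≡ e ⇔ n ∣ k
  rotation≡e⇔ k = mk⇔
    (λ eq → m%n≡0⇒n∣m k n (trans (sym (toℕ-mod k)) (trans (cong (toℕ ∘′ proj₁) eq) toℕ-e)))
    (λ n∣k → cong (_, false) (mod-cong (trans (n∣m⇒m%n≡0 k n n∣k) (sym 0%n≡0))))

  isOrder-rotation⇔ : ∀ i k → IsOrder (i , false) k ⇔ IsAdditiveOrder n (toℕ i) k
  isOrder-rotation⇔ i k = leastPositive-cong λ j →
    subst (λ g → g ≡ e ⇔ n ∣ j * toℕ i) (sym (pow-rotation i j)) (rotation≡e⇔ (j * toℕ i))

  isOrder-reflection : ∀ i → IsOrder (i , true) 2
  isOrder-reflection i = z<s , square≡e , not-1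
    where
    square≡e : pow (i , true) 2 ≡ e
    square≡e = trans (cong ((i , true) ·_) (·-identityʳ (i , true))) (reflection²≡e i)
    not-1 : ∀ j → 0 < j → j < 2 → pow (i , true) j ≢ e
    not-1 (suc zero) _ _ eq with trans (sym (·-identityʳ (i , true))) eq
    ... | ()
    not-1 (suc (suc _)) _ (s≤s (s≤s ()))

  isOrder-e : IsOrder e 1
  isOrder-e = z<s , ·-identityʳ e , λ j 0<j j<1 _ → <⇒≱ 0<j (s≤s⁻¹ j<1)

  isOrder-1⇒≡e : ∀ {g} → IsOrder g 1 → g ≡ e
  isOrder-1⇒≡e {g} (_ , g¹≡e , _) = trans (sym (·-identityʳ g)) g¹≡e

  order-exists : ∀ g → ∃ (IsOrder g)
  order-exists (i , false) with additiveOrder-exists n (toℕ i)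
  ... | k , order = k , Equivalence.from (isOrder-rotation⇔ i k) order
  order-exists (i , true) = 2 , isOrder-reflection i

  isOrder-rotation⇒∣n : ∀ {i k} → IsOrder (i , false) k → k ∣ n
  isOrder-rotation⇒∣n {i} {k} order =
    additiveOrder-∣ (Equivalence.to (isOrder-rotation⇔ i k) order) (m∣m*n (toℕ i))

  rotationOfOrder : ∀ {k} → k ∣ n → .{{NonTrivial k}} → D
  rotationOfOrder k∣n = fromℕ< (quotient-< k∣n) , false

  isOrder-rotationOfOrder : ∀ {k} (k∣n : k ∣ n) .{{_ : NonTrivial k}} → IsOrder (rotationOfOrder k∣n) k
  isOrder-rotationOfOrder {k} k∣n = Equivalence.from (isOrder-rotation⇔ _ k)
    (subst (λ c → IsAdditiveOrder n c k) (sym (toℕ-fromℕ< (quotient-< k∣n))) (additiveOrder-quotient k∣n))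

  SAdj-sym : ∀ {g h} → SAdj g h → SAdj h g
  SAdj-sym (g≢h , k , l , k-order , l-order , k∣⊎∣l) = g≢h ∘′ sym , l , k , l-order , k-order , swap k∣⊎∣l

  ≢-byOrders : ∀ {g h k l} → IsOrder g k → IsOrder h l → k ≢ l → g ≢ h
  ≢-byOrders {l = l} g-order h-order k≢l g≡h =
    k≢l (leastPositive-unique g-order (subst (λ x → IsOrder x l) (sym g≡h) h-order))

  adjacent-byOrders : ∀ {g h k l} → IsOrder g k → IsOrder h l → k ≢ l → k ∣⊎∣ l → SAdj g h
  adjacent-byOrders g-order h-order k≢l k∣⊎∣l =
    ≢-byOrders g-order h-order k≢l , _ , _ , g-order , h-order , k∣⊎∣l

  pred[n]<n : pred n < n
  pred[n]<n = ≤-reflexive (suc-pred n)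

  x⁻¹ : D
  x⁻¹ = fromℕ< pred[n]<n , false

  x⁻¹-order : IsOrder x⁻¹ n
  x⁻¹-order = Equivalence.from (isOrder-rotation⇔ _ n)
    (subst (λ c → IsAdditiveOrder n c n) (sym (toℕ-fromℕ< pred[n]<n)) (additiveOrder-pred n))

  twoPrimeDivisors⇒inducedK₅-e : 2 ≤ n → HasTwoPrimeDivisors n → InducedK₅-e SAdj
  twoPrimeDivisors⇒inducedK₅-e 2≤n (p , q , p-prime , q-prime , p≢q , p∣n , q∣n) = record
    { c₁ = e ; c₂ = x ; c₃ = x⁻¹ ; u = rotationOfOrder p∣n ; v = rotationOfOrder q∣n
    ; c₁~c₂ = adjacent-byOrders isOrder-e x-order (<⇒≢ 2≤n) (inj₁ (1∣ n))
    ; c₁~c₃ = adjacent-byOrders isOrder-e x⁻¹-order (<⇒≢ 2≤n) (inj₁ (1∣ n))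
    ; c₂~c₃ = x≢x⁻¹ , n , n , x-order , x⁻¹-order , inj₁ ∣-refl
    ; c₁~u = adjacent-byOrders isOrder-e p-order (<⇒≢ (1<p p-prime)) (inj₁ (1∣ p))
    ; c₂~u = adjacent-byOrders x-order p-order n≢p (inj₂ p∣n)
    ; c₃~u = adjacent-byOrders x⁻¹-order p-order n≢p (inj₂ p∣n)
    ; c₁~v = adjacent-byOrders isOrder-e q-order (<⇒≢ (1<p q-prime)) (inj₁ (1∣ q))
    ; c₂~v = adjacent-byOrders x-order q-order n≢q (inj₂ q∣n)
    ; c₃~v = adjacent-byOrders x⁻¹-order q-order n≢q (inj₂ q∣n)
    ; u≢v = ≢-byOrders p-order q-order p≢q
    ; u≁v = λ (_ , k , l , k-order , l-order , k∣⊎∣l) → distinctPrimes-∤ p-prime q-prime p≢q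
              (subst₂ _∣⊎∣_ (leastPositive-unique k-order p-order)
                            (leastPositive-unique l-order q-order) k∣⊎∣l)
    }
    where
    instance
      n-nonTrivial : NonTrivial n
      n-nonTrivial = n>1⇒nonTrivial 2≤n
      p-nonTrivial : NonTrivial p
      p-nonTrivial = prime⇒nonTrivial p-prime
      q-nonTrivial : NonTrivial q
      q-nonTrivial = prime⇒nonTrivial q-prime
    x : D
    x = rotationOfOrder (∣-refl {n})
    x-order : IsOrder x n
    x-order = isOrder-rotationOfOrder (∣-refl {n})
    p-order : IsOrder (rotationOfOrder p∣n) p
    p-order = isOrder-rotationOfOrder p∣n
    q-order : IsOrder (rotationOfOrder q∣n) q
    q-order = isOrder-rotationOfOrder q∣n
    n≢2 : n ≢ 2
    n≢2 n≡2 = p≢q (trans (prime∣prime⇒≡ p-prime prime[2] (subst (p ∣_) n≡2 p∣n))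
                         (sym (prime∣prime⇒≡ q-prime prime[2] (subst (q ∣_) n≡2 q∣n))))
    x≢x⁻¹ : x ≢ x⁻¹
    x≢x⁻¹ x≡x⁻¹ = n≢2 (begin
      n                     ≡⟨ suc-pred n ⟨
      suc (pred n)          ≡⟨ cong suc (toℕ-fromℕ< pred[n]<n) ⟨
      suc (toℕ (proj₁ x⁻¹)) ≡⟨ cong (suc ∘′ toℕ ∘′ proj₁) x≡x⁻¹ ⟨
      suc (toℕ (proj₁ x))   ≡⟨ cong suc (toℕ-fromℕ< (quotient-< (∣-refl {n}))) ⟩
      2                     ∎)
      where open ≡-Reasoning
    n≢p : n ≢ p
    n≢p n≡p = p≢q (sym (prime∣prime⇒≡ q-prime p-prime (subst (q ∣_) n≡p q∣n)))
    n≢q : n ≢ q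
    n≢q n≡q = p≢q (prime∣prime⇒≡ p-prime q-prime (subst (p ∣_) n≡q p∣n))

  OrderIsPowerOf : ℕ → D → Set
  OrderIsPowerOf p g = ∀ {k} → IsOrder g k → ∃ λ β → k ≡ p ^ β

  rotation-orderIsPowerOf : ∀ {p} α → Prime p → n ≡ p ^ α → ∀ i → OrderIsPowerOf p (i , false)
  rotation-orderIsPowerOf α p-prime n≡p^α i order =
    ∣p^α⇒≡p^β p-prime α (subst (_ ∣_) n≡p^α (isOrder-rotation⇒∣n order))

  reflection-orderIsPowerOf2 : ∀ i → OrderIsPowerOf 2 (i , true)
  reflection-orderIsPowerOf2 i order = 1 , leastPositive-unique order (isOrder-reflection i)

  orderIsPowerOf⇒adjacent : ∀ {p g h} → g ≢ h → OrderIsPowerOf p g → OrderIsPowerOf p h → SAdj g h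
  orderIsPowerOf⇒adjacent {p} {g} {h} g≢h g-power h-power with order-exists g | order-exists h
  ... | k , k-order | l , l-order with g-power k-order | h-power l-order
  ... | β , k≡p^β | γ , l≡p^γ =
    g≢h , k , l , k-order , l-order , subst₂ _∣⊎∣_ (sym k≡p^β) (sym l≡p^γ) (^-∣⊎∣ p β γ)

  asSum : D → Fin n ⊎ Fin n
  asSum (i , false) = inj₁ i
  asSum (i , true)  = inj₂ i

  asSum-injective : ∀ g h → asSum g ≡ asSum h → g ≡ h
  asSum-injective (i , false) (.i , false) refl = refl
  asSum-injective (i , true)  (.i , true)  refl = refl

  index : D → Fin (n + n)
  index g = join n n (asSum g)

  index-injective : ∀ g h → index g ≡ index h → g ≡ h
  index-injective g h eq = asSum-injective g h
    (trans (sym (splitAt-join n n (asSum g))) (trans (cong (splitAt n) eq) (splitAt-join n n (asSum h))))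

  powerOf2⇒lineGraph : ∀ α → n ≡ 2 ^ α → IsLineGraph D SAdj
  powerOf2⇒lineGraph α n≡2^α = complete⇒lineGraph index index-injective
    λ g h g≢h → orderIsPowerOf⇒adjacent g≢h (power g) (power h)
    where
    power : ∀ g → OrderIsPowerOf 2 g
    power (i , false) = rotation-orderIsPowerOf α prime[2] n≡2^α i
    power (i , true)  = reflection-orderIsPowerOf2 i

  leaf : D → Fin (suc (n + n))
  leaf g = suc (index g)

  -- Rotations are spokes at 0, reflections are spokes at the far end of the edge of e.
  hub : D → Fin (suc (n + n))
  hub (_ , false) = zero
  hub (_ , true)  = leaf e

  hub<leaf : ∀ g → toℕ (hub g) < toℕ (leaf g)
  hub<leaf (i , false) = z<s
  hub<leaf (i , true)  = s<s (subst₂ _<_ (sym (toℕ-↑ˡ (proj₁ e) n)) (sym (toℕ-↑ʳ n i))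
                                     (<-≤-trans (toℕ<n (proj₁ e)) (m≤m+n n (toℕ i))))

  doubleStarEdge : D → Edge (suc (n + n))
  doubleStarEdge g = (hub g , leaf g) , hub<leaf g

  doubleStarEdge-injective : ∀ g h → doubleStarEdge g ≡ doubleStarEdge h → g ≡ h
  doubleStarEdge-injective g h eq = index-injective g h (Fin.suc-injective (cong (λ E → endpoint E true) eq))

  rotation-meets-reflection⇔ : ∀ i j →
    ShareEndpoint (doubleStarEdge (i , false)) (doubleStarEdge (j , true)) ⇔ (i , false) ≡ e
  rotation-meets-reflection⇔ i j = mk⇔ to λ { refl → inj₂ (inj₂ (inj₁ refl)) }
    where
    to : ShareEndpoint (doubleStarEdge (i , false)) (doubleStarEdge (j , true)) → (i , false) ≡ e
    to (inj₂ (inj₂ (inj₁ eq))) = index-injective (i , false) e (Fin.suc-injective eq)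
    to (inj₂ (inj₂ (inj₂ eq))) with index-injective (i , false) (j , true) (Fin.suc-injective eq)
    ... | ()

  rotation~reflection⇔ : ∀ {p} α → Prime p → p ≢ 2 → n ≡ p ^ α → ∀ i j →
    SAdj (i , false) (j , true) ⇔ (i , false) ≡ e
  rotation~reflection⇔ α p-prime p≢2 n≡p^α i j = mk⇔ to
    λ { refl → (λ ()) , 1 , 2 , isOrder-e , isOrder-reflection j , inj₁ (1∣ 2) }
    where
    to : SAdj (i , false) (j , true) → (i , false) ≡ e
    to (_ , k , l , k-order , l-order , k∣⊎∣l) with rotation-orderIsPowerOf α p-prime n≡p^α i k-order
    ... | β , k≡p^β = isOrder-1⇒≡e (subst (IsOrder _) k≡1 k-order)
      where
      k≡1 : k ≡ 1
      k≡1 = trans k≡p^β (oddPrimePower-∣⊎∣2⇒≡1 p-prime p≢2 β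
              (subst₂ _∣⊎∣_ k≡p^β (leastPositive-unique l-order (isOrder-reflection j)) k∣⊎∣l))

  oddPrimePower⇒lineGraph : ∀ {p} α → Prime p → p ≢ 2 → n ≡ p ^ α → IsLineGraph D SAdj
  oddPrimePower⇒lineGraph α p-prime p≢2 n≡p^α =
    suc (n + n) , doubleStarEdge , doubleStarEdge-injective , adj⇔share
    where
    rotation-reflection : ∀ i j →
      SAdj (i , false) (j , true) ⇔ ShareEndpoint (doubleStarEdge (i , false)) (doubleStarEdge (j , true))
    rotation-reflection i j =
      ⇔-trans (rotation~reflection⇔ α p-prime p≢2 n≡p^α i j) (⇔-sym (rotation-meets-reflection⇔ i j))
    adj⇔share : ∀ g h → g ≢ h → SAdj g h ⇔ ShareEndpoint (doubleStarEdge g) (doubleStarEdge h)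
    adj⇔share (i , false) (j , false) g≢h = mk⇔ (λ _ → inj₁ refl) λ _ → orderIsPowerOf⇒adjacent g≢h
      (rotation-orderIsPowerOf α p-prime n≡p^α i) (rotation-orderIsPowerOf α p-prime n≡p^α j)
    adj⇔share (i , true) (j , true) g≢h = mk⇔ (λ _ → inj₁ refl) λ _ →
      g≢h , 2 , 2 , isOrder-reflection i , isOrder-reflection j , inj₁ ∣-refl
    adj⇔share (i , false) (j , true) _ = rotation-reflection i j
    adj⇔share (i , true) (j , false) _ = ⇔-trans (mk⇔ SAdj-sym SAdj-sym) (⇔-trans (rotation-reflection j i)
      (mk⇔ (shareEndpoint-sym rotationEdge reflectionEdge) (shareEndpoint-sym reflectionEdge rotationEdge)))
      where
      rotationEdge reflectionEdge : Edge (suc (n + n))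
      rotationEdge = doubleStarEdge (j , false)
      reflectionEdge = doubleStarEdge (i , true)

mainTheorem3 : (n : ℕ) .{{_ : NonZero n}} → 2 ≤ n →
    (IsLineGraph (Dihedral.D n) (Dihedral.SAdj n) ⇔ IsPrimePower n)
mainTheorem3 n 2≤n = mk⇔ lineGraph⇒primePower primePower⇒lineGraph
  where
  open Dihedral n using (D; SAdj)
  open OrderSupergraph n
  lineGraph⇒primePower : IsLineGraph D SAdj → IsPrimePower n
  lineGraph⇒primePower lineGraph with primePower⊎twoPrimeDivisors n 2≤n
  ... | inj₁ primePower = primePower
  ... | inj₂ twoPrimes  = ⊥-elim
          (lineGraph⇒¬inducedK₅-e proj₁ lineGraph (twoPrimeDivisors⇒inducedK₅-e 2≤n twoPrimes))
  primePower⇒lineGraph : IsPrimePower n → IsLineGraph D SAdj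
  primePower⇒lineGraph (p , α , p-prime , _ , n≡p^α) with p ≟ 2
  ... | yes refl = powerOf2⇒lineGraph α n≡p^α
  ... | no p≢2   = oddPrimePower⇒lineGraph α p-prime p≢2 n≡p^α
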